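{- Let $G$ be a graph, $r\ge 2$ an integer, and $d_r:=\prod_{2\le \ell\le r}2\,\mathrm{wcol}_\ell(G)$. Then every vertex coloring $c$ of $G$ using at most $k$ colors has a $(d_r, r)$-excellent refinement using at most $k^{d_r}$ colors.
   Context: All graphs are finite and simple; $\mathrm{dist}_G(u,v)$ denotes the length of a shortest $u$–$v$ path in $G$. A vertex coloring of $G$ is any map $c\colon V(G)\to S$; "$X$ receives $q$ colors under $c$" means $|c(X)|=q$. Weak coloring numbers: for a linear order $L$ of $V(G)$ and $v\in V(G)$, a vertex $u$ is weakly $\ell$-reachable from $v$ w.r.t. $L$ if there is a path of length at most $\ell$ between $u$ and $v$ on which $u$ is the $L$-smallest vertex; $\mathrm{WReach}_\ell[G,L,v]$ is the set of such $u$, and $\mathrm{wcol}_\ell(G)=\min_L\max_{v}|\mathrm{WReach}_\ell[G,L,v]|$ over all linear orders $L$ of $V(G)$. For $X\subseteq V(G)$ and $r\ge 1$, a superset $X'\supseteq X$ is an $r$-shortest path closure of $X$ if for all $u,v\in X$ with $\mathrm{dist}_G(u,v)=\ell\le r$, the induced subgraph $G[X']$ contains a path of length $\ell$ between $u$ and $v$. For a coloring $c$ of $G$, $r\ge 2$ and $d\ge 1$, a coloring $c'$ of $G$ is a $(d,r)$-excellent refinement of $c$ if for every vertex set $X\subseteq V(G)$ there exists an $r$-shortest path closure $X'$ of $X$ such that, if $X$ receives $p$ colors under $c'$, then $X'$ receives at most $d\cdot p$ colors under $c$. -}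

module Defs where

open import Data.Nat using (ℕ; zero; suc; _+_; _*_; _∸_; _≤_)
open import Data.Fin using (Fin; toℕ; _≟_)
open import Data.Fin.Subset using (Subset; _∈_; _∉_; _⊆_; ∣_∣)
open import Data.Fin.Subset.Properties using (_∈?_)
open import Data.Fin.Properties using (any?)
open import Data.Fin.Permutation using (Permutation′; _⟨$⟩ʳ_)
open import Data.List using (List; []; _∷_; length; map; upTo)
open import Data.Nat.ListAction using (product)
open import Data.List.Relation.Unary.All using (All)
open import Data.List.Relation.Unary.Unique.Propositional using (Unique)
open import Data.List.Membership.Propositional renaming (_∈_ to _∈ₗ_)
open import Data.Vec using (tabulate)
open import Data.Product using (Σ; ∃; _×_; _,_; proj₁)
open import Relation.Nullary using (¬_; Dec)
open import Relation.Nullary.Decidable using (⌊_⌋; _×-dec_)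
open import Relation.Binary.PropositionalEquality using (_≡_)
open import Relation.Binary using (Decidable)

record Graph : Set₁ where
  field
    n     : ℕ
    Adj   : Fin n → Fin n → Set
    adj?  : Decidable Adj
    sym   : ∀ {u v} → Adj u v → Adj v u
    irrefl : ∀ {v} → ¬ Adj v v

open Graph public

V : Graph → Set
V G = Fin (n G)

data Walk (G : Graph) : V G → V G → ℕ → Set where
  nil  : (v : V G) → Walk G v v 0
  cons : (u : V G) {w v : V G} {ℓ : ℕ} → Adj G u w → Walk G w v ℓ → Walk G u v (suc ℓ)

verts : {G : Graph} {u v : V G} {ℓ : ℕ} → Walk G u v ℓ → List (V G)
verts (nil v) = v ∷ []
verts (cons u _ p) = u ∷ verts p

Path : (G : Graph) → V G → V G → ℕ → Set
Path G u v ℓ = Σ (Walk G u v ℓ) (λ p → Unique (verts p))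

-- dist_G(u,v) = ℓ  (undefined/∞ if u,v are disconnected)
Dist : (G : Graph) → V G → V G → ℕ → Set
Dist G u v ℓ = Path G u v ℓ × (∀ m → Path G u v m → ℓ ≤ m)

PathIn : (G : Graph) → Subset (n G) → V G → V G → ℕ → Set
PathIn G X' u v ℓ = Σ (Path G u v ℓ) (λ p → All (_∈ X') (verts (proj₁ p)))

-- Linear orders of V(G), given by a rank permutation: u <_L w iff rank u < rank w.
LinOrder : Graph → Set
LinOrder G = Permutation′ (n G)

_≤[_]_ : {G : Graph} → V G → LinOrder G → V G → Set
u ≤[ L ] w = toℕ (L ⟨$⟩ʳ u) ≤ toℕ (L ⟨$⟩ʳ w)

WReach : (G : Graph) → ℕ → LinOrder G → V G → V G → Set
WReach G ℓ L v u =
  Σ ℕ λ m → m ≤ ℓ × Σ (Path G u v m) (λ p → All (λ x → _≤[_]_ {G} u L x) (verts (proj₁ p)))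

AtMost : {A : Set} → (A → Set) → ℕ → Set
AtMost {A} P w = Σ (List A) λ xs → length xs ≤ w × (∀ x → P x → x ∈ₗ xs)

IsWcol : Graph → ℕ → ℕ → Set
IsWcol G ℓ w =
  (Σ (LinOrder G) λ L → ∀ v → AtMost (WReach G ℓ L v) w)
  × (∀ (L : LinOrder G) (w' : ℕ) → (∀ v → AtMost (WReach G ℓ L v) w') → w ≤ w')

-- number of colors received by X under c, i.e. |c(X)|
numColors : {G : Graph} {k : ℕ} → (V G → Fin k) → Subset (n G) → ℕ
numColors {G} c X = ∣ tabulate (λ j → ⌊ any? (λ x → (x ∈? X) ×-dec (c x ≟ j)) ⌋) ∣

IsSPClosure : (G : Graph) → ℕ → Subset (n G) → Subset (n G) → Set
IsSPClosure G r X X' =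
  X ⊆ X' × (∀ u v ℓ → u ∈ X → v ∈ X → Dist G u v ℓ → ℓ ≤ r → PathIn G X' u v ℓ)

IsExcellentRefinement : (G : Graph) (d r : ℕ) {k k' : ℕ} → (V G → Fin k) → (V G → Fin k') → Set
IsExcellentRefinement G d r c c' =
  ∀ (X : Subset (n G)) → Σ (Subset (n G)) λ X' →
    IsSPClosure G r X X' × numColors {G} c X' ≤ d * numColors {G} c' X

-- d_r = ∏_{2 ≤ ℓ ≤ r} 2 · wc ℓ
dProd : (ℕ → ℕ) → ℕ → ℕ
dProd wc r = product (map (λ i → 2 * wc (2 + i)) (upTo (r ∸ 1)))

module Submission where

-- Fix an order L attaining wcol_r(G) and lists W u ⊇ WReach_r[G,L,u] of
-- length ≤ wcol_r.  For m ∈ W u take a shortest walk of length ≤ r from m to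
-- u staying L-above m (a shortcut); span u is u plus these shortcuts, so
-- |span u| ≤ 1 + (wcol_r − 1)·r ≤ 2^(r−1)·wcol_r ≤ d_r.  The union of the
-- spans over X is an r-shortest path closure of X: a shortest u–v path of
-- length ≤ r splits at its L-least vertex m, weakly r-reachable from u and
-- v, and the shortcuts from m replace both halves without lengthening them.
-- Colouring x by the tuple of c-colours of span x (in Fin (k^d)) is then a
-- (d,r)-excellent refinement, since every c-colour on the closure is an
-- entry of a tuple seen on X.

open import Defs
open import Data.Nat using (ℕ; zero; suc; _+_; _*_; _^_; _≤_; _<_; z≤n; s≤s; _≤?_)
open import Data.Nat.Properties hiding (_≟_)
open import Data.Nat.ListAction using (product)
open import Data.Nat.ListAction.Properties using (product-++)
open import Data.Fin using (Fin; zero; suc; toℕ; _≟_; funToFin; finToFun)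
open import Data.Fin.Properties using (any?; finToFun-funToFin)
open import Data.Fin.Permutation using (_⟨$⟩ʳ_)
open import Data.Fin.Subset using (Subset; ∣_∣) renaming (_∈_ to _∈ˢ_)
open import Data.Fin.Subset.Properties using () renaming (_∈?_ to _∈ˢ?_)
open import Data.Vec using (tabulate)
open import Data.Vec.Properties using (lookup∘tabulate; []=⇒lookup; lookup⇒[]=)
open import Data.Bool.Properties using (T-≡)
open import Data.List as List using (List; []; _∷_; [_]; _∷ʳ_; length; map; _++_; concatMap; upTo)
open import Data.List.Properties using (length-++; length-map; length-tabulate; length-upTo; map-++; upTo-∷ʳ)
open import Data.List.Relation.Unary.All as All using (All; []; _∷_)
open import Data.List.Relation.Unary.All.Properties using (anti-mono; applyUpTo⁺₁) renaming (map⁺ to All-map⁺)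
open import Data.List.Relation.Unary.Any using (here; there)
open import Data.List.Relation.Unary.AllPairs using ([]; _∷_)
open import Data.List.Relation.Unary.Unique.Propositional using (Unique)
open import Data.List.Relation.Binary.Subset.Propositional using (_⊆_)
open import Data.List.Relation.Binary.Subset.Propositional.Properties using (⊆-trans)
open import Data.List.Membership.Propositional using (_∈_; lose)
open import Data.List.Membership.Propositional.Properties using (∈-++⁻; ∈-++⁺ˡ; ∈-++⁺ʳ; ∈-tabulate⁺; ∈-map⁺; ∈-concatMap⁺)
import Data.List.Membership.DecPropositional as DecMembership
open import Data.List.Extrema.Nat using (argmin; argmin-all; f[argmin]≤f[xs])
open import Data.Product using (Σ; ∃; _×_; _,_; proj₁; proj₂)
open import Data.Sum as Sum using (_⊎_; inj₁; inj₂; [_,_]′)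
open import Function using (_∘_; id)
open import Function.Bundles using (Equivalence)
open import Relation.Nullary using (¬_; Dec; yes; no; contradiction)
open import Relation.Nullary.Decidable using (_×-dec_; ⌊_⌋; fromWitness; toWitness)
open import Relation.Binary.PropositionalEquality using (_≡_; refl; trans; cong; subst) renaming (sym to ≡-sym)

lowest : {A : Set} (f : A → ℕ) (xs : List A) {x : A} → x ∈ xs →
         Σ A λ m → m ∈ xs × All (λ y → f m ≤ f y) xs
lowest f xs {x} x∈xs = argmin f x xs , argmin-all f x∈xs (All.tabulate id) , f[argmin]≤f[xs] {f = f} x xs

length-concatMap≤ : {A B : Set} (f : A → List B) (r : ℕ) (xs : List A) →
                    (∀ z → length (f z) ≤ r) → length (concatMap f xs) ≤ length xs * r
length-concatMap≤ f r [] bound = z≤n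
length-concatMap≤ f r (x ∷ xs) bound = begin
  length (f x ++ concatMap f xs)          ≡⟨ length-++ (f x) ⟩
  length (f x) + length (concatMap f xs)  ≤⟨ +-mono-≤ (bound x) (length-concatMap≤ f r xs bound) ⟩
  r + length xs * r                       ∎
  where open ≤-Reasoning

length-concatMap≤-empty : {A B : Set} (f : A → List B) (r : ℕ) {xs : List A} {y : A} →
                          (∀ z → length (f z) ≤ r) → y ∈ xs → length (f y) ≡ 0 →
                          length (concatMap f xs) + r ≤ length xs * r
length-concatMap≤-empty f r {y ∷ xs} bound (here refl) empty = begin
  length (f y ++ concatMap f xs) + r            ≡⟨ cong (_+ r) (trans (length-++ (f y)) (cong (_+ _) empty)) ⟩
  length (concatMap f xs) + r                   ≡⟨ +-comm _ r ⟩
  r + length (concatMap f xs)                   ≤⟨ +-monoʳ-≤ r (length-concatMap≤ f r xs bound) ⟩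
  r + length xs * r                             ∎
  where open ≤-Reasoning
length-concatMap≤-empty f r {x ∷ xs} bound (there y∈xs) empty = begin
  length (f x ++ concatMap f xs) + r            ≡⟨ cong (_+ r) (length-++ (f x)) ⟩
  length (f x) + length (concatMap f xs) + r    ≡⟨ +-assoc (length (f x)) _ r ⟩
  length (f x) + (length (concatMap f xs) + r)  ≤⟨ +-mono-≤ (bound x) (length-concatMap≤-empty f r bound y∈xs empty) ⟩
  r + length xs * r                             ∎
  where open ≤-Reasoning

padLookup : {A : Set} {d : ℕ} → List A → A → Fin d → A
padLookup []       default i       = default
padLookup (a ∷ as) default zero    = a
padLookup (a ∷ as) default (suc i) = padLookup as default i

padLookup-complete : {A : Set} {d : ℕ} (xs : List A) (default : A) {y : A} →
                     y ∈ xs → length xs ≤ d → ∃ λ (i : Fin d) → padLookup xs default i ≡ y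
padLookup-complete (a ∷ as) default (here refl)  (s≤s _)  = zero , refl
padLookup-complete (a ∷ as) default (there y∈as) (s≤s as≤) with padLookup-complete as default y∈as as≤
... | i , eq = suc i , eq

⟦_⟧ : {m : ℕ} {P : Fin m → Set} → (∀ y → Dec (P y)) → Subset m
⟦ P? ⟧ = tabulate (λ y → ⌊ P? y ⌋)

∈⟦⟧⁺ : {m : ℕ} {P : Fin m → Set} (P? : ∀ y → Dec (P y)) {y : Fin m} → P y → y ∈ˢ ⟦ P? ⟧
∈⟦⟧⁺ P? {y} py = lookup⇒[]= y ⟦ P? ⟧ (trans (lookup∘tabulate _ y) (Equivalence.to T-≡ (fromWitness py)))

∈⟦⟧⁻ : {m : ℕ} {P : Fin m → Set} (P? : ∀ y → Dec (P y)) {y : Fin m} → y ∈ˢ ⟦ P? ⟧ → P y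
∈⟦⟧⁻ P? {y} y∈ = toWitness (Equivalence.from T-≡ (trans (≡-sym (lookup∘tabulate _ y)) ([]=⇒lookup y∈)))

⋃ : {m : ℕ} → Subset m → (Fin m → List (Fin m)) → Subset m
⋃ {m} X f = ⟦ (λ y → any? (λ x → (x ∈ˢ? X) ×-dec (y ∈? f x))) ⟧
  where open DecMembership (_≟_ {m}) using (_∈?_)

⋃⁺ : {m : ℕ} (X : Subset m) (f : Fin m → List (Fin m)) {x y : Fin m} → x ∈ˢ X → y ∈ f x → y ∈ˢ ⋃ X f
⋃⁺ X f x∈X y∈fx = ∈⟦⟧⁺ _ (_ , x∈X , y∈fx)

⋃⁻ : {m : ℕ} (X : Subset m) (f : Fin m → List (Fin m)) {y : Fin m} → y ∈ˢ ⋃ X f → ∃ λ x → x ∈ˢ X × y ∈ f x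
⋃⁻ X f y∈ = ∈⟦⟧⁻ _ y∈

unsuc : {k : ℕ} → List (Fin (suc k)) → List (Fin k)
unsuc []           = []
unsuc (zero  ∷ js) = unsuc js
unsuc (suc j ∷ js) = j ∷ unsuc js

unsuc-∈ : {k : ℕ} {j : Fin k} {js : List (Fin (suc k))} → suc j ∈ js → j ∈ unsuc js
unsuc-∈ {js = zero  ∷ js} (there j∈) = unsuc-∈ j∈
unsuc-∈ {js = suc _ ∷ js} (here refl) = here refl
unsuc-∈ {js = suc _ ∷ js} (there j∈) = there (unsuc-∈ j∈)

unsuc-length : {k : ℕ} (js : List (Fin (suc k))) → length (unsuc js) ≤ length js
unsuc-length []           = z≤n
unsuc-length (zero  ∷ js) = m≤n⇒m≤1+n (unsuc-length js)
unsuc-length (suc _ ∷ js) = s≤s (unsuc-length js)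

unsuc-length-zero : {k : ℕ} {js : List (Fin (suc k))} → zero ∈ js → suc (length (unsuc js)) ≤ length js
unsuc-length-zero {js = zero  ∷ js} _          = s≤s (unsuc-length js)
unsuc-length-zero {js = suc _ ∷ js} (there z∈) = s≤s (unsuc-length-zero z∈)

count≤length : {k : ℕ} {P : Fin k → Set} (P? : ∀ j → Dec (P j)) (js : List (Fin k)) →
               (∀ j → P j → j ∈ js) → ∣ ⟦ P? ⟧ ∣ ≤ length js
count≤length {zero}  P? js covers = z≤n
count≤length {suc k} P? js covers
  with P? zero | count≤length (P? ∘ suc) (unsuc js) (λ j p → unsuc-∈ (covers (suc j) p))
... | yes p0 | rest = ≤-trans (s≤s rest) (unsuc-length-zero (covers zero p0))
... | no _   | rest = ≤-trans rest (unsuc-length js)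

enumerate : {k : ℕ} {P : Fin k → Set} (P? : ∀ j → Dec (P j)) →
            Σ (List (Fin k)) λ js → length js ≤ ∣ ⟦ P? ⟧ ∣ × (∀ j → P j → j ∈ js)
enumerate {zero}  P? = [] , z≤n , λ ()
enumerate {suc k} P? with P? zero | enumerate (P? ∘ suc)
... | yes p0  | js , len , covers = zero ∷ map suc js , s≤s (≤-trans (≤-reflexive (length-map suc js)) len) ,
      λ { zero _ → here refl ; (suc j) p → there (∈-map⁺ suc (covers j p)) }
... | no ¬p0 | js , len , covers = map suc js , ≤-trans (≤-reflexive (length-map suc js)) len ,
      λ { zero p → contradiction p ¬p0 ; (suc j) p → ∈-map⁺ suc (covers j p) }

module Walks (G : Graph) where
  open DecMembership (_≟_ {n G}) using (_∈?_)

  _++ᵂ_ : ∀ {x y z a b} → Walk G x y a → Walk G y z b → Walk G x z (a + b)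
  nil _      ++ᵂ q = q
  cons u e p ++ᵂ q = cons u e (p ++ᵂ q)

  ++ᵂ-verts : ∀ {x y z a b} (p : Walk G x y a) (q : Walk G y z b) → verts (p ++ᵂ q) ⊆ verts p ++ verts q
  ++ᵂ-verts (nil _)      q v∈        = there v∈
  ++ᵂ-verts (cons u e p) q (here eq) = here eq
  ++ᵂ-verts (cons u e p) q (there v∈) = there (++ᵂ-verts p q v∈)

  _∷ʳᵂ_ : ∀ {x y z a} → Walk G x y a → Adj G y z → Walk G x z (suc a)
  nil x       ∷ʳᵂ e = cons x e (nil _)
  cons u e′ p ∷ʳᵂ e = cons u e′ (p ∷ʳᵂ e)

  ∷ʳᵂ-verts : ∀ {x y z a} (p : Walk G x y a) (e : Adj G y z) → verts (p ∷ʳᵂ e) ⊆ verts p ∷ʳ z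
  ∷ʳᵂ-verts (nil x)       e v∈         = v∈
  ∷ʳᵂ-verts (cons u e′ p) e (here eq)  = here eq
  ∷ʳᵂ-verts (cons u e′ p) e (there v∈) = there (∷ʳᵂ-verts p e v∈)

  reverseᵂ : ∀ {x y a} → Walk G x y a → Walk G y x a
  reverseᵂ (nil v)      = nil v
  reverseᵂ (cons u e p) = reverseᵂ p ∷ʳᵂ Graph.sym G e

  reverseᵂ-verts : ∀ {x y a} (p : Walk G x y a) → verts (reverseᵂ p) ⊆ verts p
  reverseᵂ-verts (nil v)      v∈ = v∈
  reverseᵂ-verts (cons u e p) v∈ with ∈-++⁻ (verts (reverseᵂ p)) (∷ʳᵂ-verts (reverseᵂ p) (Graph.sym G e) v∈)
  ... | inj₁ v∈p       = there (reverseᵂ-verts p v∈p)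
  ... | inj₂ (here eq) = here eq

  start∈verts : ∀ {x y a} (p : Walk G x y a) → x ∈ verts p
  start∈verts (nil _)      = here refl
  start∈verts (cons _ _ _) = here refl

  initVerts : ∀ {x y a} → Walk G x y a → List (V G)
  initVerts (nil _)      = []
  initVerts (cons u e p) = u ∷ initVerts p

  initVerts-length : ∀ {x y a} (p : Walk G x y a) → length (initVerts p) ≡ a
  initVerts-length (nil _)      = refl
  initVerts-length (cons u e p) = cong suc (initVerts-length p)

  verts⊆end∷initVerts : ∀ {x y a} (p : Walk G x y a) → verts p ⊆ y ∷ initVerts p
  verts⊆end∷initVerts (nil _)      (here eq)  = here eq
  verts⊆end∷initVerts (cons u e p) (here eq)  = there (here eq)
  verts⊆end∷initVerts (cons u e p) (there v∈) with verts⊆end∷initVerts p v∈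
  ... | here eq  = here eq
  ... | there w∈ = there (there w∈)

  splitAt : ∀ {x y a} (p : Walk G x y a) {m} → m ∈ verts p →
            Σ ℕ λ a₁ → Σ ℕ λ a₂ → a₁ + a₂ ≡ a × Σ (Walk G x m a₁) λ p₁ → Σ (Walk G m y a₂) λ p₂ →
              verts p₁ ⊆ verts p × verts p₂ ⊆ verts p
  splitAt (nil v)      (here refl) = 0 , 0 , refl , nil v , nil v , id , id
  splitAt (cons u e p) (here refl) = 0 , _ , refl , nil u , cons u e p , (λ { (here eq) → here eq }) , id
  splitAt (cons u e p) (there m∈) with splitAt p m∈
  ... | a₁ , a₂ , eq , p₁ , p₂ , p₁⊆ , p₂⊆ =
        suc a₁ , a₂ , cong suc eq , cons u e p₁ , p₂ , (λ { (here eq) → here eq ; (there v∈) → there (p₁⊆ v∈) }) , there ∘ p₂⊆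

  suffixFrom : ∀ {x y a} (p : Walk G x y a) {w} → w ∈ verts p →
               Σ ℕ λ b → b ≤ a × Σ (Walk G w y b) λ q → verts q ⊆ verts p × (Unique (verts p) → Unique (verts q))
  suffixFrom (nil v)      (here refl) = 0 , z≤n , nil v , id , id
  suffixFrom (cons u e p) (here refl) = _ , ≤-refl , cons u e p , id , id
  suffixFrom (cons u e p) (there w∈) with suffixFrom p w∈
  ... | b , b≤ , q , q⊆ , unique = b , m≤n⇒m≤1+n b≤ , q , there ∘ q⊆ , λ { (_ ∷ p-unique) → unique p-unique }

  toPath : ∀ {x y a} (p : Walk G x y a) → Σ ℕ λ b → b ≤ a × Σ (Path G x y b) λ q → verts (proj₁ q) ⊆ verts p
  toPath (nil v) = 0 , z≤n , (nil v , [] ∷ []) , id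
  toPath (cons u e p) with toPath p
  ... | b , b≤ , (q , q-unique) , q⊆ with u ∈? verts q
  ...   | yes u∈q with suffixFrom q u∈q
  ...     | b′ , b′≤ , q′ , q′⊆ , unique = b′ , m≤n⇒m≤1+n (≤-trans b′≤ b≤) , (q′ , unique q-unique) , there ∘ q⊆ ∘ q′⊆
  toPath (cons u e p) | b , b≤ , (q , q-unique) , q⊆ | no u∉q =
    suc b , s≤s b≤ , (cons u e q , All.tabulate (λ { v∈q refl → u∉q v∈q }) ∷ q-unique) ,
    λ { (here eq) → here eq ; (there v∈) → there (q⊆ v∈) }

  pathWithin : ∀ {X' u v ℓ a} → Dist G u v ℓ → a ≤ ℓ → (w : Walk G u v a) → All (_∈ˢ X') (verts w) →
               PathIn G X' u v ℓ
  pathWithin {X'} {u} {v} (_ , minimal) a≤ℓ w w-inside with toPath w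
  ... | b , b≤a , path , path⊆w =
        subst (PathIn G X' u v) (≤-antisym (≤-trans b≤a a≤ℓ) (minimal b path)) (path , anti-mono path⊆w w-inside)

  WalkInside : List (V G) → V G → V G → ℕ → Set
  WalkInside S x y a = Σ ℕ λ b → b ≤ a × Σ (Walk G x y b) λ q → verts q ⊆ S

  WalkWithin : (V G → Set) → V G → V G → ℕ → Set
  WalkWithin Q x y a = Σ (Walk G x y a) λ w → All Q (verts w)

  walkWithin? : (Q : V G → Set) → (∀ z → Dec (Q z)) → ∀ x y a → Dec (WalkWithin Q x y a)
  walkWithin? Q Q? x y zero with x ≟ y | Q? x
  ... | no x≢y   | _     = no λ { (nil _ , _) → x≢y refl }
  ... | yes refl | yes q = yes (nil x , q ∷ [])
  ... | yes refl | no ¬q = no λ { (nil _ , q ∷ []) → ¬q q }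
  walkWithin? Q Q? x y (suc a) with Q? x ×-dec any? (λ w → adj? G x w ×-dec walkWithin? Q Q? w y a)
  ... | yes (qx , w , e , (p , qp)) = yes (cons x e p , qx ∷ qp)
  ... | no ¬step = no λ { (cons _ e p , qx ∷ qp) → ¬step (qx , _ , e , (p , qp)) }

Search : (ℕ → Set) → ℕ → Set
Search P t = (Σ ℕ λ a → a ≤ t × P a × (∀ b → b ≤ t → P b → a ≤ b)) ⊎ (∀ b → b ≤ t → ¬ P b)

≤-suc-cases : ∀ {b t} → b ≤ suc t → b ≤ t ⊎ b ≡ suc t
≤-suc-cases b≤ = Sum.map₁ m<1+n⇒m≤n (m≤n⇒m<n∨m≡n b≤)

least? : {P : ℕ → Set} → (∀ a → Dec (P a)) → ∀ t → Search P t
least? P? zero with P? zero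
... | yes p = inj₁ (zero , z≤n , p , λ _ _ _ → z≤n)
... | no ¬p = inj₂ λ { zero _ → ¬p }
least? P? (suc t) with least? P? t
... | inj₁ (a , a≤t , pa , least) =
      inj₁ (a , m≤n⇒m≤1+n a≤t , pa , λ b b≤ pb →
        [ (λ b≤t → least b b≤t pb) , (λ { refl → m≤n⇒m≤1+n a≤t }) ]′ (≤-suc-cases b≤))
... | inj₂ none with P? (suc t)
...   | yes p = inj₁ (suc t , ≤-refl , p , λ b b≤ pb →
        [ (λ b≤t → contradiction pb (none b b≤t)) , (λ { refl → ≤-refl }) ]′ (≤-suc-cases b≤))
...   | no ¬p = inj₂ λ b b≤ → [ none b , (λ { refl → ¬p }) ]′ (≤-suc-cases b≤)

module Shortcuts (G : Graph) (L : LinOrder G) (r : ℕ) where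
  open Walks G

  rank : V G → ℕ
  rank x = toℕ (L ⟨$⟩ʳ x)

  Above : V G → V G → Set
  Above m z = _≤[_]_ {G} m L z

  above? : ∀ m z → Dec (Above m z)
  above? m z = rank m ≤? rank z

  search : (m u : V G) → Search (WalkWithin (Above m) m u) r
  search m u = least? (walkWithin? (Above m) (above? m) m u) r

  shortcutOf : ∀ {m u} → Search (WalkWithin (Above m) m u) r → List (V G)
  shortcutOf (inj₁ (_ , _ , (w , _) , _)) = initVerts w
  shortcutOf (inj₂ _)                     = []

  shortcut : V G → V G → List (V G)
  shortcut m u = shortcutOf (search m u)

  shortcutOf-length : ∀ {m u} (res : Search (WalkWithin (Above m) m u) r) → length (shortcutOf res) ≤ r
  shortcutOf-length (inj₁ (a , a≤r , (w , _) , _)) = subst (_≤ r) (≡-sym (initVerts-length w)) a≤r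
  shortcutOf-length (inj₂ _)                       = z≤n

  shortcutOf-shortest : ∀ {m u a} (res : Search (WalkWithin (Above m) m u) r) → a ≤ r →
                        WalkWithin (Above m) m u a →
                        Σ ℕ λ b → b ≤ a × Σ (Walk G m u b) λ q → shortcutOf res ≡ initVerts q
  shortcutOf-shortest (inj₁ (b , _ , (q , _) , least)) a≤r w = b , least _ a≤r w , q , refl
  shortcutOf-shortest (inj₂ none)                      a≤r w = contradiction w (none _ a≤r)

  shortcut-length : ∀ m u → length (shortcut m u) ≤ r
  shortcut-length m u = shortcutOf-length (search m u)

  -- The trivial walk shows that the shortcut from u to itself is empty.
  shortcut-self : ∀ u → length (shortcut u u) ≡ 0
  shortcut-self u with shortcutOf-shortest (search u u) z≤n (nil u , ≤-refl ∷ [])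
  ... | _ , z≤n , q , eq = trans (cong length eq) (initVerts-length q)

  shortcut-walk : ∀ {m u a} → a ≤ r → WalkWithin (Above m) m u a → WalkInside (u ∷ shortcut m u) m u a
  shortcut-walk {m} {u} a≤r w with shortcutOf-shortest (search m u) a≤r w
  ... | b , b≤a , q , eq = b , b≤a , q , subst (λ xs → verts q ⊆ u ∷ xs) (≡-sym eq) (verts⊆end∷initVerts q)

reach-self : (G : Graph) (ℓ : ℕ) (L : LinOrder G) (v : V G) → WReach G ℓ L v v
reach-self G ℓ L v = 0 , z≤n , (nil v , [] ∷ []) , ≤-refl ∷ []

module Spans (G : Graph) (L : LinOrder G) (r : ℕ) (W : V G → List (V G))
             (W-covers : ∀ v m → WReach G r L v m → m ∈ W v) where
  open Walks G
  open Shortcuts G L r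

  shortcuts : V G → List (V G)
  shortcuts u = concatMap (λ m → shortcut m u) (W u)

  span : V G → List (V G)
  span u = u ∷ shortcuts u

  -- |span u| ≤ 1 + (|W u| − 1)·r, as the shortcut from u to itself is empty.
  shortcuts-size : ∀ u → length (shortcuts u) + r ≤ length (W u) * r
  shortcuts-size u = length-concatMap≤-empty (λ m → shortcut m u) r (λ m → shortcut-length m u)
                       (W-covers u u (reach-self G r L u)) (shortcut-self u)

  -- A walk of length ≤ r from m to u above m shows m ∈ WReach_r[G,L,u], so
  -- the shortcut from m to u lies in span u.
  span-walk : ∀ {m u a} → a ≤ r → WalkWithin (Above m) m u a → WalkInside (span u) m u a
  span-walk {m} {u} a≤r (w , w-above) with toPath w | shortcut-walk a≤r (w , w-above)
  ... | b , b≤a , path , path⊆w | b′ , b′≤a , q , q⊆ = b′ , b′≤a , q , widen ∘ q⊆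
    where
    m∈W : m ∈ W u
    m∈W = W-covers u m (b , ≤-trans b≤a a≤r , path , anti-mono path⊆w w-above)
    widen : u ∷ shortcut m u ⊆ span u
    widen (here eq)  = here eq
    widen (there v∈) = there (∈-concatMap⁺ (λ m → shortcut m u) (lose m∈W v∈))

  -- A walk of length ≤ r from u to v can be rerouted, no longer, through
  -- span u and span v: split it at its L-least vertex m and use the two
  -- walks from m provided by span-walk.
  reroute : ∀ {u v ℓ} → ℓ ≤ r → Walk G u v ℓ → WalkInside (span u ++ span v) u v ℓ
  reroute {u} {v} ℓ≤r p with lowest rank (verts p) (start∈verts p)
  ... | m , m∈p , m-lowest with splitAt p m∈p
  ... | a₁ , a₂ , a₁+a₂≡ℓ , p₁ , p₂ , p₁⊆p , p₂⊆p
      with span-walk (≤-trans (≤-trans (m≤m+n a₁ a₂) (≤-reflexive a₁+a₂≡ℓ)) ℓ≤r)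
                     (reverseᵂ p₁ , anti-mono (⊆-trans (reverseᵂ-verts p₁) p₁⊆p) m-lowest)
         | span-walk (≤-trans (≤-trans (m≤n+m a₂ a₁) (≤-reflexive a₁+a₂≡ℓ)) ℓ≤r)
                     (p₂ , anti-mono p₂⊆p m-lowest)
  ... | b₁ , b₁≤a₁ , q₁ , q₁⊆ | b₂ , b₂≤a₂ , q₂ , q₂⊆ =
        b₁ + b₂ , ≤-trans (+-mono-≤ b₁≤a₁ b₂≤a₂) (≤-reflexive a₁+a₂≡ℓ) , reverseᵂ q₁ ++ᵂ q₂ ,
        λ v∈ → inSpans (∈-++⁻ (verts (reverseᵂ q₁)) (++ᵂ-verts (reverseᵂ q₁) q₂ v∈))
    where
    inSpans : ∀ {y} → y ∈ verts (reverseᵂ q₁) ⊎ y ∈ verts q₂ → y ∈ span u ++ span v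
    inSpans (inj₁ y∈) = ∈-++⁺ˡ (q₁⊆ (reverseᵂ-verts q₁ y∈))
    inSpans (inj₂ y∈) = ∈-++⁺ʳ (span u) (q₂⊆ y∈)

  span-closure : ∀ X → IsSPClosure G r X (⋃ X span)
  span-closure X = (λ x∈X → ⋃⁺ X span x∈X (here refl)) , connect
    where
    connect : ∀ u v ℓ → u ∈ˢ X → v ∈ˢ X → Dist G u v ℓ → ℓ ≤ r → PathIn G (⋃ X span) u v ℓ
    connect u v ℓ u∈X v∈X dist ℓ≤r with reroute ℓ≤r (proj₁ (proj₁ dist))
    ... | b , b≤ℓ , q , q⊆ = pathWithin dist b≤ℓ q (All.tabulate (inClosure ∘ q⊆))
      where
      inClosure : ∀ {y} → y ∈ span u ++ span v → y ∈ˢ ⋃ X span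
      inClosure y∈ with ∈-++⁻ (span u) y∈
      ... | inj₁ y∈u = ⋃⁺ X span u∈X y∈u
      ... | inj₂ y∈v = ⋃⁺ X span v∈X y∈v

colours-of-entries : (G : Graph) {k d : ℕ} (c : V G → Fin k) (c' : V G → Fin (k ^ d)) (X X' : Subset (n G)) →
                     (∀ y → y ∈ˢ X' → ∃ λ x → x ∈ˢ X × ∃ λ i → finToFun {k} {d} (c' x) i ≡ c y) →
                     numColors {G} c X' ≤ d * numColors {G} c' X
colours-of-entries G {k} {d} c c' X X' entry with enumerate (λ j → any? (λ x → (x ∈ˢ? X) ×-dec (c' x ≟ j)))
... | seen , seen≤ , seen-covers = begin
  numColors {G} c X'             ≤⟨ count≤length _ (concatMap tuple seen) covers ⟩
  length (concatMap tuple seen)  ≤⟨ length-concatMap≤ tuple d seen (λ z → ≤-reflexive (length-tabulate (finToFun {k} {d} z))) ⟩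
  length seen * d                ≤⟨ *-monoˡ-≤ d seen≤ ⟩
  numColors {G} c' X * d         ≡⟨ *-comm _ d ⟩
  d * numColors {G} c' X         ∎
  where
  open ≤-Reasoning
  tuple : Fin (k ^ d) → List (Fin k)
  tuple z = List.tabulate (finToFun {k} {d} z)
  covers : ∀ j → (∃ λ y → y ∈ˢ X' × c y ≡ j) → j ∈ concatMap tuple seen
  covers j (y , y∈X' , refl) with entry y y∈X'
  ... | x , x∈X , i , eq =
        ∈-concatMap⁺ tuple (lose (seen-covers (c' x) (x , x∈X , refl)) (subst (_∈ tuple (c' x)) eq (∈-tabulate⁺ i)))

-- Spans of size ≤ d whose unions are r-shortest path closures yield a
-- (d,r)-excellent refinement with k^d colours: x gets the tuple of
-- c-colours of span x.
refinement-from-spans : (G : Graph) (d r : ℕ) {k : ℕ} (c : V G → Fin k) (span : V G → List (V G)) →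
                        (∀ x → length (span x) ≤ d) → (∀ X → IsSPClosure G r X (⋃ X span)) →
                        Σ (V G → Fin (k ^ d)) λ c' → IsExcellentRefinement G d r c c'
refinement-from-spans G d r {k} c span small closed =
  c' , λ X → ⋃ X span , closed X , colours-of-entries G {k} {d} c c' X (⋃ X span) (entry X)
  where
  c' : V G → Fin (k ^ d)
  c' x = funToFin {d} {k} (λ i → c (padLookup (span x) x i))
  entry : ∀ X y → y ∈ˢ ⋃ X span → ∃ λ x → x ∈ˢ X × ∃ λ i → finToFun {k} {d} (c' x) i ≡ c y
  entry X y y∈ with ⋃⁻ X span y∈
  ... | x , x∈X , y∈span with padLookup-complete (span x) x y∈span (small x)
  ...   | i , refl = x , x∈X , i , finToFun-funToFin {d} {k} _ i

1+n≤2^n : ∀ n → suc n ≤ 2 ^ n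
1+n≤2^n zero    = ≤-refl
1+n≤2^n (suc n) = begin
  1 + suc n      ≤⟨ +-mono-≤ (m^n>0 2 n) (1+n≤2^n n) ⟩
  2 ^ n + 2 ^ n  ≡⟨ cong (2 ^ n +_) (≡-sym (+-identityʳ _)) ⟩
  2 ^ suc n      ∎
  where open ≤-Reasoning

2^length≤product : ∀ xs → All (2 ≤_) xs → 2 ^ length xs ≤ product xs
2^length≤product []       []           = ≤-refl
2^length≤product (x ∷ xs) (2≤x ∷ 2≤xs) = *-mono-≤ 2≤x (2^length≤product xs 2≤xs)

dProd-bound : ∀ wc s → (∀ i → i < s → 1 ≤ wc (2 + i)) → 2 ^ suc s * wc (2 + s) ≤ dProd wc (2 + s)
dProd-bound wc s positive = begin
  2 ^ suc s * wc (2 + s)            ≡⟨ cong (_* wc (2 + s)) (*-comm 2 (2 ^ s)) ⟩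
  2 ^ s * 2 * wc (2 + s)            ≡⟨ trans (*-assoc (2 ^ s) 2 _) (cong (2 ^ s *_) (≡-sym (*-identityʳ _))) ⟩
  2 ^ s * last                      ≡⟨ cong (λ l → 2 ^ l * last) (≡-sym (trans (length-map factor (upTo s)) (length-upTo s))) ⟩
  2 ^ length front * last           ≤⟨ *-monoˡ-≤ last (2^length≤product front front≥2) ⟩
  product front * last              ≡⟨ ≡-sym (product-++ front [ factor s ]) ⟩
  product (front ++ [ factor s ])   ≡⟨ cong product (≡-sym (map-++ factor (upTo s) [ s ])) ⟩
  product (map factor (upTo s ∷ʳ s)) ≡⟨ cong (product ∘ map factor) (upTo-∷ʳ s) ⟩
  dProd wc (2 + s)                  ∎
  where
  open ≤-Reasoning
  factor : ℕ → ℕ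
  factor i = 2 * wc (2 + i)
  front : List ℕ
  front = map factor (upTo s)
  last : ℕ
  last = factor s * 1
  front≥2 : All (2 ≤_) front
  front≥2 = All-map⁺ (applyUpTo⁺₁ id s (λ {i} i<s → *-monoʳ-≤ 2 (positive i i<s)))

span-arithmetic : ∀ C w t → C + suc t ≤ w * suc t → suc C ≤ 2 ^ t * w
span-arithmetic C zero    t le = contradiction (≤-trans (m≤n+m (suc t) C) le) λ ()
span-arithmetic C (suc w) t le = begin
  suc C                 ≤⟨ s≤s (+-cancelʳ-≤ (suc t) C (w * suc t) (≤-trans le (≤-reflexive (+-comm (suc t) _)))) ⟩
  1 + w * suc t         ≤⟨ +-mono-≤ (m^n>0 2 t) (*-monoʳ-≤ w (1+n≤2^n t)) ⟩
  2 ^ t + w * 2 ^ t     ≡⟨ cong (2 ^ t +_) (*-comm w (2 ^ t)) ⟩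
  2 ^ t + 2 ^ t * w     ≡⟨ ≡-sym (*-suc (2 ^ t) w) ⟩
  2 ^ t * suc w         ∎
  where open ≤-Reasoning

wcol-positive : (G : Graph) (ℓ w : ℕ) → IsWcol G ℓ w → V G → 1 ≤ w
wcol-positive G ℓ w ((L , bounded) , _) v with bounded v
... | xs , xs≤w , covers = ≤-trans (nonempty (covers v (reach-self G ℓ L v))) xs≤w
  where
  nonempty : ∀ {xs : List (V G)} → v ∈ xs → 1 ≤ length xs
  nonempty {_ ∷ _} _ = s≤s z≤n

lemma2 : (G : Graph) (r : ℕ) → 2 ≤ r →
    (wc : ℕ → ℕ) → (∀ ℓ → 2 ≤ ℓ → ℓ ≤ r → IsWcol G ℓ (wc ℓ)) →
    (k : ℕ) (c : V G → Fin k) →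
    Σ (V G → Fin (k ^ dProd wc r)) (λ c' → IsExcellentRefinement G (dProd wc r) r c c')
lemma2 G (suc (suc s)) (s≤s (s≤s z≤n)) wc isWcol k c =
  refinement-from-spans G (dProd wc r) r c span span-size span-closure
  where
  r : ℕ
  r = 2 + s
  optimal : Σ (LinOrder G) λ L → ∀ v → AtMost (WReach G r L v) (wc r)
  optimal = proj₁ (isWcol r (s≤s (s≤s z≤n)) ≤-refl)
  W : V G → List (V G)
  W v = proj₁ (proj₂ optimal v)
  open Spans G (proj₁ optimal) r W (λ v → proj₂ (proj₂ (proj₂ optimal v)))
  span-size : ∀ u → length (span u) ≤ dProd wc r
  span-size u = ≤-trans
    (span-arithmetic _ (wc r) (suc s) (≤-trans (shortcuts-size u) (*-monoˡ-≤ r (proj₁ (proj₂ (proj₂ optimal u))))))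
    (dProd-bound wc s λ i i<s → wcol-positive G (2 + i) _ (isWcol (2 + i) (s≤s (s≤s z≤n)) (s≤s (s≤s (<⇒≤ i<s)))) u)
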